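{- Let $T$ be a binary tree with $m$ nodes, of which $m_0$ are leaves, and root $u$. Then $$\sum_{v\in T}(l_v+r_v)=2m-L_u-R_u\qquad\text{and}\qquad \sum_{v\in T}m_v\le m-L_u-R_u+m_0.$$
   Context: The left spine of a node $u$ is the set of nodes on the downward path starting at $u$ (inclusive) that repeatedly follows left children as long as possible; the right spine is defined analogously with right children. The left inner spine of $u$ is the right spine of the left child of $u$ (empty if there is no left child); the right inner spine of $u$ is the left spine of the right child of $u$ (empty if there is no right child). $L_v$, $R_v$ denote the numbers of nodes in the left and right spines of $v$, and $l_v$, $r_v$ the numbers of nodes in the left and right inner spines of $v$. Finally $m_v=\max(l_v+r_v-1,0)$. -}

module Defs where

open import Data.Nat using (ℕ; zero; suc; _+_; _∸_; _⊔_)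

-- Binary trees; `nil` is the empty tree (absent child), `node l r` a node
-- with left subtree l and right subtree r (either possibly empty).
data BT : Set where
  nil  : BT
  node : BT → BT → BT

size : BT → ℕ
size nil        = 0
size (node l r) = suc (size l + size r)

leaves : BT → ℕ
leaves nil               = 0
leaves (node nil nil)    = 1
leaves (node l r)        = leaves l + leaves r

leftSpine : BT → ℕ
leftSpine nil        = 0
leftSpine (node l r) = suc (leftSpine l)

rightSpine : BT → ℕ
rightSpine nil        = 0
rightSpine (node l r) = suc (rightSpine r)

innerL : BT → ℕ
innerL nil        = 0
innerL (node l r) = rightSpine l

innerR : BT → ℕ
innerR nil        = 0
innerR (node l r) = leftSpine r

-- m_v = max(l_v + r_v - 1, 0)  (truncated subtraction in ℕ)
mval : BT → ℕ
mval t = (innerL t + innerR t) ∸ 1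

-- sum of f over all subtrees rooted at nodes v of T (i.e. over all nodes)
sumNodes : (BT → ℕ) → BT → ℕ
sumNodes f nil          = 0
sumNodes f (node l r)   = f (node l r) + sumNodes f l + sumNodes f r

module Submission where

open import Defs
open import Data.Nat using (ℕ; _+_; _*_; _≤_; suc; s≤s; z≤n)
open import Data.Nat.Properties using (m+[n∸m]≡n; +-mono-≤; ≤-refl; module ≤-Reasoning)
open import Data.Nat.Tactic.RingSolver using (solve-∀)
open import Data.Product using (_×_; _,_)
open import Relation.Binary.PropositionalEquality using (_≡_; refl; cong; cong₂; module ≡-Reasoning)

-- At a node the inner spines are the right spine of the left child and the left
-- spine of the right child, while the node's own spines are the outer spines of
-- the children extended by the node itself.  Hence l_u + r_u + L_u + R_u is the
-- total length of the four spines of the children plus two, and both statements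
-- follow by induction over the tree.  For m_v the root contributes one less than
-- l_u + r_u unless it is a leaf, and each leaf is paid for by the term m_0.

innerSum : BT → ℕ
innerSum v = innerL v + innerR v

sumInner+spines-node : ∀ l r → let t = node l r in
  sumNodes innerSum t + leftSpine t + rightSpine t
    ≡ 2 + (sumNodes innerSum l + leftSpine l + rightSpine l)
        + (sumNodes innerSum r + leftSpine r + rightSpine r)
sumInner+spines-node l r =
  regroup (rightSpine l) (leftSpine r) (sumNodes innerSum l) (sumNodes innerSum r)
          (leftSpine l) (rightSpine r)
  where
  regroup : ∀ rl lr sl sr ll rr →
    rl + lr + sl + sr + suc ll + suc rr ≡ 2 + (sl + ll + rl) + (sr + lr + rr)
  regroup = solve-∀

sumInner+spines≡2*size : ∀ t → sumNodes innerSum t + leftSpine t + rightSpine t ≡ 2 * size t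
sumInner+spines≡2*size nil        = refl
sumInner+spines≡2*size (node l r) = begin
  sumNodes innerSum (node l r) + leftSpine (node l r) + rightSpine (node l r)
    ≡⟨ sumInner+spines-node l r ⟩
  2 + (sumNodes innerSum l + leftSpine l + rightSpine l)
    + (sumNodes innerSum r + leftSpine r + rightSpine r)
    ≡⟨ cong₂ (λ a b → 2 + a + b) (sumInner+spines≡2*size l) (sumInner+spines≡2*size r) ⟩
  2 + 2 * size l + 2 * size r
    ≡⟨ double (size l) (size r) ⟩
  2 * size (node l r) ∎
  where
  open ≡-Reasoning
  double : ∀ a b → 2 + 2 * a + 2 * b ≡ 2 * suc (a + b)
  double = solve-∀

suc-mval-node : ∀ l r → 1 ≤ rightSpine l + leftSpine r →
  suc (mval (node l r)) ≡ rightSpine l + leftSpine r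
suc-mval-node l r = m+[n∸m]≡n

sumM+spines-node : ∀ l r → 1 ≤ rightSpine l + leftSpine r → let t = node l r in
  sumNodes mval t + leftSpine t + rightSpine t
    ≡ suc ((sumNodes mval l + leftSpine l + rightSpine l)
         + (sumNodes mval r + leftSpine r + rightSpine r))
sumM+spines-node l r inner≥1 = begin
  m + Ml + Mr + suc (leftSpine l) + suc (rightSpine r)
    ≡⟨ pull-m m Ml Mr (leftSpine l) (rightSpine r) ⟩
  suc (suc m + (Ml + leftSpine l) + (Mr + rightSpine r))
    ≡⟨ cong (λ k → suc (k + (Ml + leftSpine l) + (Mr + rightSpine r))) (suc-mval-node l r inner≥1) ⟩
  suc (rightSpine l + leftSpine r + (Ml + leftSpine l) + (Mr + rightSpine r))
    ≡⟨ cong suc (regroup (rightSpine l) (leftSpine r) Ml (leftSpine l) Mr (rightSpine r)) ⟩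
  suc ((Ml + leftSpine l + rightSpine l) + (Mr + leftSpine r + rightSpine r)) ∎
  where
  open ≡-Reasoning
  m  = mval (node l r)
  Ml = sumNodes mval l
  Mr = sumNodes mval r
  pull-m : ∀ m a b c d → m + a + b + suc c + suc d ≡ suc (suc m + (a + c) + (b + d))
  pull-m = solve-∀
  regroup : ∀ rl lr a ll b rr → rl + lr + (a + ll) + (b + rr) ≡ (a + ll + rl) + (b + lr + rr)
  regroup = solve-∀

sumM+spines≤size+leaves-internal : ∀ l r → 1 ≤ rightSpine l + leftSpine r →
  sumNodes mval l + leftSpine l + rightSpine l ≤ size l + leaves l →
  sumNodes mval r + leftSpine r + rightSpine r ≤ size r + leaves r →
  let t = node l r in
  sumNodes mval t + leftSpine t + rightSpine t ≤ size t + (leaves l + leaves r)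
sumM+spines≤size+leaves-internal l r inner≥1 bound-l bound-r = begin
  sumNodes mval (node l r) + leftSpine (node l r) + rightSpine (node l r)
    ≡⟨ sumM+spines-node l r inner≥1 ⟩
  suc ((sumNodes mval l + leftSpine l + rightSpine l)
     + (sumNodes mval r + leftSpine r + rightSpine r))
    ≤⟨ s≤s (+-mono-≤ bound-l bound-r) ⟩
  suc ((size l + leaves l) + (size r + leaves r))
    ≡⟨ cong suc (regroup (size l) (leaves l) (size r) (leaves r)) ⟩
  size (node l r) + (leaves l + leaves r) ∎
  where
  open ≤-Reasoning
  regroup : ∀ a b c d → (a + b) + (c + d) ≡ (a + c) + (b + d)
  regroup = solve-∀

sumM+spines≤size+leaves : ∀ t → sumNodes mval t + leftSpine t + rightSpine t ≤ size t + leaves t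
sumM+spines≤size+leaves nil                     = z≤n
sumM+spines≤size+leaves (node nil nil)          = ≤-refl
sumM+spines≤size+leaves (node nil r@(node _ _)) =
  sumM+spines≤size+leaves-internal nil r (s≤s z≤n) z≤n (sumM+spines≤size+leaves r)
sumM+spines≤size+leaves (node l@(node _ _) r)   =
  sumM+spines≤size+leaves-internal l r (s≤s z≤n)
    (sumM+spines≤size+leaves l) (sumM+spines≤size+leaves r)

lemma5 : (l r : BT) →
    let T = node l r in
    (sumNodes (λ v → innerL v + innerR v) T + leftSpine T + rightSpine T ≡ 2 * size T)
    × (sumNodes mval T + leftSpine T + rightSpine T ≤ size T + leaves T)
lemma5 l r = sumInner+spines≡2*size (node l r) , sumM+spines≤size+leaves (node l r)
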